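{- Let $\mathbb{D}=A\cup B$ where $d^*(B)=0$. Then for any $l\in\mathbb{N}$ there exist an integer $j\ge 0$ and $d\in\mathbb{N}$ such that $2^{ -j}d\cdot[l]=\{2^{ -j}d,2\cdot2^{ -j}d,\dots,l\cdot 2^{ -j}d\}\subseteq A$.
   Context: $\mathbb{D}=\bigcup_{j=0}^\infty 2^{ -j}\cdot\mathbb{Z}$ is the set of dyadic rationals, where $c\cdot S=\{cs:s\in S\}$. $[n]=\{1,\dots,n\}$. For $S\subseteq\mathbb{D}$, $d_j(S)=\limsup_{n\to\infty}|S\cap(2^{ -j}\cdot[n])|/n$ and $d^*(S)=\limsup_{j\to\infty}d_j(S)$. -}

module Defs where

open import Data.Nat using (ℕ; _^_; _*_; _≤_; _<_; NonZero)
open import Data.Nat.Properties using (m^n≢0)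
open import Data.Integer using (ℤ; +_)
open import Data.Rational using (ℚ; _/_)
open import Data.List using (List; length)
open import Data.List.Relation.Unary.All using (All)
open import Data.List.Relation.Unary.Unique.Propositional using (Unique)
open import Data.Product using (Σ; ∃; _×_)
open import Relation.Binary.PropositionalEquality using (_≡_)

dy : ℕ → ℤ → ℚ
dy j m = _/_ m (2 ^ j) {{m^n≢0 2 j}}

IsDyadic : ℚ → Set
IsDyadic x = ∃ λ j → ∃ λ m → x ≡ dy j m

-- "|S ∩ (2^{-j}·[n])| ≤ c" for a (not necessarily decidable) S ⊆ ℚ,
-- scaled form: q·|S ∩ 2^{-j}[n]| ≤ p·n  (i.e. the count is ≤ (p/q)·n):
-- every duplicate-free list of indices i ∈ [n] with 2^{-j} i ∈ S has length ℓ with q·ℓ ≤ p·n.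
CountBound : (ℚ → Set) → (j n p q : ℕ) → Set
CountBound S j n p q =
  (T : List ℕ) → Unique T →
  All (λ i → (1 ≤ i) × (i ≤ n) × S (dy j (+ i))) T →
  q * length T ≤ p * n

-- d*(S) = 0, i.e. limsup_j limsup_n |S ∩ 2^{-j}[n]|/n = 0, unfolded with rational ε = p/q > 0:
-- ∀ ε>0 ∃ J ∀ j ≥ J ∃ N ∀ n ≥ N, |S ∩ 2^{-j}[n]| ≤ ε n.
UpperDensityZero : (ℚ → Set) → Set
UpperDensityZero S =
  (p q : ℕ) → 0 < p → 0 < q →
  ∃ λ J → (j : ℕ) → J ≤ j →
  ∃ λ N → (n : ℕ) → N ≤ n → CountBound S j n p q

module Submission where

open import Defs
open import Level using (Level)
open import Data.Bool using (Bool; true; false; T)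
open import Data.Empty using (⊥-elim)
open import Data.Nat using (ℕ; zero; suc; _+_; _*_; _≤_; _<_; z≤n; s≤s; z<s; NonZero; >-nonZero; >-nonZero⁻¹)
open import Data.Nat.Properties
open import Data.Integer using (+_)
open import Data.Rational using (ℚ)
open import Data.Sum using (_⊎_; inj₁; inj₂)
open import Data.Product using (∃; _×_; _,_)
open import Data.List using (List; _∷_; length; filter; applyDownFrom)
open import Data.List.Properties using (filter-accept)
open import Data.List.Relation.Unary.All as All using (All)
open import Data.List.Relation.Unary.All.Properties using (all-filter; filter⁺; applyDownFrom⁺₁)
open import Data.List.Relation.Unary.Unique.Propositional using (Unique)
import Data.List.Relation.Unary.Unique.Propositional.Properties as Unique
open import Relation.Nullary using (¬_; yes; no)
open import Relation.Nullary.Decidable using (T?)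
open import Relation.Unary using (Pred; Decidable)
open import Relation.Binary.PropositionalEquality using (refl; sym; cong)

-- Fix a scale 2^{-J} at which B has density below 1/(l²+1) on all long enough ranges [n].
-- If no d ∈ [M] has d·[l] inside A, every d ∈ [M] has some multiple d·k (k ∈ [l]) in B,
-- so summing over k ∈ [l] the number of d ∈ [M] with d·k ∈ B gives at least M. For fixed k
-- these d·k are distinct elements of B ∩ 2^{-J}[Ml], so each summand is at most Ml/(l²+1),
-- and M ≤ l · Ml/(l²+1) < M.

private
  variable
    a b p : Level

multiples : ℕ → ℕ → List ℕ
multiples k M = applyDownFrom (λ d → suc d * k) M

module _ {P : Pred ℕ p} (P? : Decidable P) where

  length-filter-∷ : ∀ x xs → length (filter P? xs) ≤ length (filter P? (x ∷ xs))
  length-filter-∷ x xs with P? x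
  ... | yes Px = n≤1+n _
  ... | no ¬Px = ≤-refl

  flaggedMultiples : ℕ → ℕ → List ℕ
  flaggedMultiples k M = filter P? (multiples k M)

  flaggedMultiples-unique : ∀ k M .{{_ : NonZero k}} → Unique (flaggedMultiples k M)
  flaggedMultiples-unique k M = Unique.filter⁺ P?
    (Unique.applyDownFrom⁺₁ _ M (λ j<i _ → >⇒≢ (*-monoˡ-< k (s≤s j<i))))

  flaggedMultiples-bounded : ∀ k M .{{_ : NonZero k}} →
    All (λ i → (1 ≤ i) × (i ≤ M * k) × P i) (flaggedMultiples k M)
  flaggedMultiples-bounded k M = All.map (λ ((pos , bnd) , Pi) → pos , bnd , Pi)
    (All.zip (filter⁺ P? inRange , all-filter P? (multiples k M)))
    where
      inRange : All (λ i → (1 ≤ i) × (i ≤ M * k)) (multiples k M)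
      inRange = applyDownFrom⁺₁ _ M λ {d} d<M →
        ≤-trans (>-nonZero⁻¹ k) (m≤m+n k (d * k)) , *-monoˡ-≤ k d<M

  flaggedCount : ℕ → ℕ → ℕ
  flaggedCount zero    M = 0
  flaggedCount (suc l) M = length (flaggedMultiples (suc l) M) + flaggedCount l M

  flaggedCount-mono : ∀ l M → flaggedCount l M ≤ flaggedCount l (suc M)
  flaggedCount-mono zero    M = z≤n
  flaggedCount-mono (suc l) M =
    +-mono-≤ (length-filter-∷ (suc M * suc l) _) (flaggedCount-mono l M)

  flaggedCount-step : ∀ {l n} M → n < l → P (suc M * suc n) →
    flaggedCount l M < flaggedCount l (suc M)
  flaggedCount-step {suc l} {n} M (s≤s n≤l) P[Mn] with n ≟ l
  ... | yes refl = +-mono-<-≤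
          (≤-reflexive (sym (cong length (filter-accept P? P[Mn]))))
          (flaggedCount-mono l M)
  ... | no n≢l = +-mono-≤-<
          (length-filter-∷ (suc M * suc l) _)
          (flaggedCount-step M (≤∧≢⇒< n≤l n≢l) P[Mn])

  unflaggedMultiplier⊎flaggedCount≥ : ∀ l M →
    (∃ λ d → (1 ≤ d) × (∀ k → 1 ≤ k → k ≤ l → ¬ P (d * k))) ⊎ (M ≤ flaggedCount l M)
  unflaggedMultiplier⊎flaggedCount≥ l zero = inj₂ z≤n
  unflaggedMultiplier⊎flaggedCount≥ l (suc M) with unflaggedMultiplier⊎flaggedCount≥ l M
  ... | inj₁ good = inj₁ good
  ... | inj₂ M≤count with anyUpTo? (λ n → P? (suc M * suc n)) l
  ...   | yes (n , n<l , P[Mn]) = inj₂ (≤-<-trans M≤count (flaggedCount-step M n<l P[Mn]))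
  ...   | no noFlag = inj₁ (suc M , s≤s z≤n , λ { (suc n) _ n<l P[Mn] → noFlag (n , n<l , P[Mn]) })

  flaggedCount-bound : ∀ q {c} l M →
    (∀ k → 1 ≤ k → k ≤ l → q * length (flaggedMultiples k M) ≤ c) →
    q * flaggedCount l M ≤ l * c
  flaggedCount-bound q zero M _ = ≤-reflexive (*-zeroʳ q)
  flaggedCount-bound q {c} (suc l) M bound = begin
    q * flaggedCount (suc l) M
      ≡⟨ *-distribˡ-+ q (length (flaggedMultiples (suc l) M)) (flaggedCount l M) ⟩
    q * length (flaggedMultiples (suc l) M) + q * flaggedCount l M
      ≤⟨ +-mono-≤ (bound (suc l) (s≤s z≤n) ≤-refl)
                  (flaggedCount-bound q l M λ k 1≤k k≤l → bound k 1≤k (m≤n⇒m≤1+n k≤l)) ⟩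
    c + l * c ∎
    where open ≤-Reasoning

l*[M*l]<[1+l*l]*M : ∀ l M → 0 < M → l * (M * l) < suc (l * l) * M
l*[M*l]<[1+l*l]*M l M 0<M = begin-strict
  l * (M * l)  ≡⟨ cong (l *_) (*-comm M l) ⟩
  l * (l * M)  ≡⟨ *-assoc l l M ⟨
  l * l * M    <⟨ m<n+m (l * l * M) 0<M ⟩
  M + l * l * M ∎
  where open ≤-Reasoning

module _ {X : Set a} {Y : Set b} where

  isInj₂ᵇ : X ⊎ Y → Bool
  isInj₂ᵇ (inj₁ _) = false
  isInj₂ᵇ (inj₂ _) = true

  fromInj₂ᵇ : (s : X ⊎ Y) → T (isInj₂ᵇ s) → Y
  fromInj₂ᵇ (inj₂ y) _ = y

  fromInj₁ᵇ : (s : X ⊎ Y) → ¬ T (isInj₂ᵇ s) → X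
  fromInj₁ᵇ (inj₁ x) _    = x
  fromInj₁ᵇ (inj₂ _) ¬inB = ⊥-elim (¬inB _)

module _ {A′ B′ : Pred ℕ p} (split : ∀ m → A′ m ⊎ B′ m) where

  private
    -- Membership in B′ need not be decidable; the side chosen by split is.
    inB? : Decidable (λ m → T (isInj₂ᵇ (split m)))
    inB? m = T? (isInj₂ᵇ (split m))

  sparse⇒dilatedInterval⊆ : ∀ l M → 0 < M →
    (1 ≤ l → (T : List ℕ) → Unique T → All (λ i → (1 ≤ i) × (i ≤ M * l) × B′ i) T →
      suc (l * l) * length T ≤ M * l) →
    ∃ λ d → (1 ≤ d) × (∀ k → 1 ≤ k → k ≤ l → A′ (d * k))
  sparse⇒dilatedInterval⊆ l M 0<M sparse with unflaggedMultiplier⊎flaggedCount≥ inB? l M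
  ... | inj₁ (d , 1≤d , good) =
    d , 1≤d , λ k 1≤k k≤l → fromInj₁ᵇ (split (d * k)) (good k 1≤k k≤l)
  ... | inj₂ M≤count = ⊥-elim (<⇒≱ (l*[M*l]<[1+l*l]*M l M 0<M) (begin
      suc (l * l) * M                      ≤⟨ *-monoʳ-≤ (suc (l * l)) M≤count ⟩
      suc (l * l) * flaggedCount inB? l M  ≤⟨ flaggedCount-bound inB? (suc (l * l)) l M fewFlags ⟩
      l * (M * l)                          ∎))
    where
      open ≤-Reasoning
      fewFlags : ∀ k → 1 ≤ k → k ≤ l → suc (l * l) * length (flaggedMultiples inB? k M) ≤ M * l
      fewFlags k@(suc _) _ k≤l = sparse (≤-trans z<s k≤l)
        (flaggedMultiples inB? k M) (flaggedMultiples-unique inB? k M)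
        (All.map (λ (pos , bnd , flagged) → pos , ≤-trans bnd (*-monoʳ-≤ M k≤l) , fromInj₂ᵇ (split _) flagged)
                 (flaggedMultiples-bounded inB? k M))

lemma3p2 : (A B : ℚ → Set) →
    (∀ x → A x → IsDyadic x) → (∀ x → B x → IsDyadic x) →
    (∀ x → IsDyadic x → A x ⊎ B x) →
    UpperDensityZero B →
    (l : ℕ) → ∃ λ j → ∃ λ d → (1 ≤ d) ×
      ((k : ℕ) → 1 ≤ k → k ≤ l → A (dy j (+ (d * k))))
lemma3p2 A B _ _ cover densB l
  with J , sparseFrom ← densB 1 (suc (l * l)) z<s z<s
  with N , sparse ← sparseFrom J ≤-refl =
  J , sparse⇒dilatedInterval⊆ split l (suc N) z<s sparseBelow
  where
    split : ∀ m → A (dy J (+ m)) ⊎ B (dy J (+ m))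
    split m = cover (dy J (+ m)) (J , + m , refl)

    sparseBelow : 1 ≤ l → (T : List ℕ) → Unique T →
      All (λ i → (1 ≤ i) × (i ≤ suc N * l) × B (dy J (+ i))) T →
      suc (l * l) * length T ≤ suc N * l
    sparseBelow 1≤l T T! T⊆B = begin
      suc (l * l) * length T  ≤⟨ sparse (suc N * l) N≤ T T! T⊆B ⟩
      1 * (suc N * l)         ≡⟨ *-identityˡ (suc N * l) ⟩
      suc N * l               ∎
      where
        open ≤-Reasoning
        N≤ : N ≤ suc N * l
        N≤ = ≤-trans (n≤1+n N) (m≤m*n (suc N) l {{>-nonZero 1≤l}})
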